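{- Let $\rho$ be an inheritable and heavy basic hyperparameter such that $\alpha\text{ - }\rho$ is bounded on the class of disjoint unions of complete graphs. Then $\bigcup_c\mathcal B_{\alpha\text{ - }\mu_{\rho,c}}\subsetneq\mathcal B_{\alpha\text{ - }\rho}$, where the union is over all integers $c$.
   Context: All graphs are finite, simple and undirected; $\alpha$ denotes the independence number. A graph class is a set of graphs closed under isomorphism. A hypergraph over $G$ is a nonempty set of subsets of $V(G)$; a hypermapping $\mathcal F$ assigns to each graph $G$ a finite nonempty family $\mathcal F_G$ of hypergraphs over $G$, compatibly with isomorphisms. For $\lambda\in\{\mathtt{card},\alpha\}$ with $\mathtt{card}(G,X)=|X|$, $\alpha(G,X)=\alpha(G[X])$, and a basic hyperparameter $\rho=(\mathrm{opt},\mathcal F)$ with $\mathrm{opt}\in\{\mathrm{minmax},\mathrm{maxmin}\}$, define $\lambda\text{ - }\rho(G)=\min_{H\in\mathcal F_G}\max_{X\in H}\lambda(G,X)$ (minmax) or $\max_{H\in\mathcal F_G}\min_{X\in H}\lambda(G,X)$ (maxmin); $\rho(G)=\mathtt{card}\text{ - }\rho(G)$. $\rho$ is inheritable if for each $\lambda\in\{\mathtt{card},\alpha\}$, every $G$ and every $S\subseteq V(G)$, $\lambda\text{ - }\rho(G)\le\rho(G-S)+\lambda(G,S)$. $\rho$ is heavy if $G\mapsto\rho(G)$ is monotone under induced subgraphs and unbounded on complete graphs. For an integer $c$, a $(\rho,c)$-modulator of $G$ is a set $S$ with $\rho(G-S)\le c$, and $\alpha\text{ - }\mu_{\rho,c}(G)$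 is the minimum $\alpha(G[S])$ over all such $S$. For a parameter $\sigma$, $\mathcal B_\sigma$ is the family of graph classes $\mathcal G$ with bounded $\sigma$, i.e., there is an integer $k$ with $\sigma(G')\le k$ for every induced subgraph $G'$ of every $G\in\mathcal G$. -}

module Defs where

open import Data.Bool using (Bool; true; false; _∧_; not; if_then_else_)
open import Data.Nat using (ℕ; zero; suc; _≤_; _<_; _⊓_; _⊔_; _≤ᵇ_)
open import Data.Fin using (Fin; zero; suc)
open import Data.Fin.Subset using (Subset; inside; outside; ∁; ∣_∣; ⊤)
open import Data.Vec using (Vec; []; _∷_; lookup; tabulate)
open import Data.List using (List; []; _∷_; _++_; allFin; foldr)
import Data.List as L
open import Data.List.NonEmpty using (List⁺; foldr₁)
import Data.List.NonEmpty as L⁺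
open import Data.List.Membership.Propositional using (_∈_)
open import Data.Product using (Σ; ∃; _×_; _,_)
open import Function.Bundles using (_↔_; Inverse; _⇔_)
open import Relation.Binary.PropositionalEquality using (_≡_; _≢_; refl)
open import Relation.Nullary using (¬_)

record Graph : Set where
  field
    n     : ℕ
    adj   : Fin n → Fin n → Bool
    sym   : ∀ i j → adj i j ≡ adj j i
    irref : ∀ i → adj i i ≡ false
open Graph public

VSet : Graph → Set
VSet G = Subset (n G)

record Iso (G G′ : Graph) : Set where
  field
    π       : Fin (n G) ↔ Fin (n G′)
    preserv : ∀ i j → adj G′ (Inverse.to π i) (Inverse.to π j) ≡ adj G i j
open Iso public

imgSet : ∀ {G G′} → Iso G G′ → VSet G → VSet G′
imgSet φ X = tabulate (λ j → lookup X (Inverse.from (π φ) j))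

embed : ∀ {m} (X : Subset m) → Fin ∣ X ∣ → Fin m
embed (true  ∷ X) zero    = zero
embed (true  ∷ X) (suc i) = suc (embed X i)
embed (false ∷ X) i       = suc (embed X i)

induced : (G : Graph) → VSet G → Graph
induced G X = record
  { n     = ∣ X ∣
  ; adj   = λ i j → adj G (embed X i) (embed X j)
  ; sym   = λ i j → sym G (embed X i) (embed X j)
  ; irref = λ i → irref G (embed X i)
  }

_-ˢ_ : (G : Graph) → VSet G → Graph
G -ˢ S = induced G (∁ S)

allSubsets : (m : ℕ) → List (Subset m)
allSubsets zero    = [] ∷ []
allSubsets (suc m) = L.map (true ∷_) (allSubsets m) ++ L.map (false ∷_) (allSubsets m)

allB : ∀ {A : Set} → (A → Bool) → List A → Bool
allB p []       = true
allB p (x ∷ xs) = p x ∧ allB p xs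

isIndep : (G : Graph) → VSet G → Bool
isIndep G Y = allB (λ i → allB (λ j → not (lookup Y i ∧ lookup Y j ∧ adj G i j)) (allFin (n G))) (allFin (n G))

αG : Graph → ℕ
αG G = foldr _⊔_ 0 (L.map (λ Y → if isIndep G Y then ∣ Y ∣ else 0) (allSubsets (n G)))

Measure : Set
Measure = (G : Graph) → VSet G → ℕ

card : Measure
card G X = ∣ X ∣

αm : Measure
αm G X = αG (induced G X)

data IsLam : Measure → Set where
  isCard : IsLam card
  isα    : IsLam αm

Hypergraph : Graph → Set
Hypergraph G = List⁺ (VSet G)

Family : Graph → Set
Family G = List⁺ (Hypergraph G)

_≈H_ : ∀ {G} → Hypergraph G → Hypergraph G → Set
H ≈H H′ = ∀ X → (X ∈ L⁺.toList H) ⇔ (X ∈ L⁺.toList H′)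

imgH : ∀ {G G′} → Iso G G′ → Hypergraph G → Hypergraph G′
imgH φ H = L⁺.map (imgSet φ) H

record Hypermapping : Set where
  field
    F : (G : Graph) → Family G
    compat→ : ∀ G G′ (φ : Iso G G′) → ∀ H → H ∈ L⁺.toList (F G) →
              Σ (Hypergraph G′) λ H′ → (H′ ∈ L⁺.toList (F G′)) × (_≈H_ {G′} H′ (imgH φ H))
    compat← : ∀ G G′ (φ : Iso G G′) → ∀ H′ → H′ ∈ L⁺.toList (F G′) →
              Σ (Hypergraph G) λ H → (H ∈ L⁺.toList (F G)) × (_≈H_ {G′} H′ (imgH φ H))
open Hypermapping public

data Opt : Set where
  minmax maxmin : Opt

record BasicHyperparameter : Set where
  field
    opt : Opt
    hm  : Hypermapping
open BasicHyperparameter public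

maxL⁺ minL⁺ : List⁺ ℕ → ℕ
maxL⁺ = foldr₁ _⊔_
minL⁺ = foldr₁ _⊓_

lamRho : Measure → BasicHyperparameter → Graph → ℕ
lamRho lam ρ G with opt ρ
... | minmax = minL⁺ (L⁺.map (λ H → maxL⁺ (L⁺.map (lam G) H)) (F (hm ρ) G))
... | maxmin = maxL⁺ (L⁺.map (λ H → minL⁺ (L⁺.map (lam G) H)) (F (hm ρ) G))

rhoVal : BasicHyperparameter → Graph → ℕ
rhoVal = lamRho card

Inheritable : BasicHyperparameter → Set
Inheritable ρ = ∀ lam → IsLam lam → ∀ (G : Graph) (S : VSet G) →
  lamRho lam ρ G ≤ rhoVal ρ (G -ˢ S) Data.Nat.+ lam G S

neqF : ∀ {m} → Fin m → Fin m → Bool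
neqF zero    zero    = false
neqF zero    (suc j) = true
neqF (suc i) zero    = true
neqF (suc i) (suc j) = neqF i j

neqF-sym : ∀ {m} (i j : Fin m) → neqF i j ≡ neqF j i
neqF-sym zero    zero    = refl
neqF-sym zero    (suc j) = refl
neqF-sym (suc i) zero    = refl
neqF-sym (suc i) (suc j) = neqF-sym i j

neqF-irr : ∀ {m} (i : Fin m) → neqF i i ≡ false
neqF-irr zero    = refl
neqF-irr (suc i) = neqF-irr i

K : ℕ → Graph
K m = record { n = m ; adj = neqF ; sym = neqF-sym ; irref = neqF-irr }

Heavy : BasicHyperparameter → Set
Heavy ρ = (∀ (G : Graph) (X : VSet G) → rhoVal ρ (induced G X) ≤ rhoVal ρ G)
        × (∀ (k : ℕ) → Σ ℕ λ m → k < rhoVal ρ (K m))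

record GraphClass : Set₁ where
  field
    mem    : Graph → Set
    closed : ∀ G G′ → Iso G G′ → mem G → mem G′
open GraphClass public

-- disjoint unions of complete graphs: vertices are partitioned into parts
-- (labelled by f), each part a clique, no edges between different parts
IsDisjUnionCliques : Graph → Set
IsDisjUnionCliques G =
  Σ (Fin (n G) → ℕ) λ f → ∀ i j → (adj G i j ≡ true) ⇔ ((i ≢ j) × (f i ≡ f j))

-- The fold starts from n(G), which is ≥ α(G[S]) for every S; since
-- S = V(G) is always a modulator (ρ of the null graph is 0), this is the
-- exact minimum.
alphaMu : BasicHyperparameter → ℕ → Graph → ℕ
alphaMu ρ c G =
  foldr _⊓_ (n G)
    (L.map (λ S → if rhoVal ρ (G -ˢ S) ≤ᵇ c then αm G S else n G) (allSubsets (n G)))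

Bounded : (Graph → ℕ) → GraphClass → Set
Bounded σ 𝒢 = Σ ℕ λ k → ∀ G → mem 𝒢 G → ∀ (X : VSet G) → σ (induced G X) ≤ k

InUnionBMu : BasicHyperparameter → GraphClass → Set
InUnionBMu ρ 𝒢 = Σ ℕ λ c → Bounded (alphaMu ρ c) 𝒢

InBAlphaRho : BasicHyperparameter → GraphClass → Set
InBAlphaRho ρ 𝒢 = Bounded (lamRho αm ρ) 𝒢

-- Inheritability gives α-ρ(G) ≤ ρ(G - S) + α(G[S]) ≤ c + α(G[S]) for every (ρ,c)-modulator S,
-- so a bound on α-μ_{ρ,c} yields one on α-ρ. For strictness take t disjoint copies of K_m, where
-- ρ(K_m) > c. A modulator S must meet every copy, since a copy avoided by S survives in G - S and
-- forces ρ(G - S) ≥ ρ(K_m) by heaviness; choosing one vertex of S in each copy gives an independent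
-- set of size t inside S. Hence α-μ_{ρ,c} ≥ t on disjoint unions of cliques, while α-ρ stays bounded
-- there by hypothesis.
module Submission where

open import Defs hiding (sym)
open import Data.Bool using (Bool; true; false; not; _∧_; T; if_then_else_)
open import Data.Bool.Properties using (∧-identityʳ; ∧-zeroʳ; ¬-not)
open import Data.Empty using (⊥-elim)
open import Data.Fin using (Fin; zero; suc; toℕ; splitAt; _↑ˡ_; _↑ʳ_; quotient; _≟_)
open import Data.Fin.Properties
  using (splitAt-↑ˡ; splitAt-↑ʳ; splitAt⁻¹-↑ˡ; splitAt⁻¹-↑ʳ; toℕ-injective; suc-injective; 0≢1+n)
open import Data.Fin.Subset using (Subset; ∣_∣; ⊤; ⊥; ∁; ⁅_⁆)
open import Data.Fin.Subset.Properties using (∣p∣≤n; ∣⊤∣≡n; ∣⊥∣≡0; ∣⁅x⁆∣≡1; ∣∁p∣≡n∸∣p∣; x∈⁅y⁆⇒x≡y; nonempty?)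
open import Data.List using (List; []; _∷_; foldr; allFin)
import Data.List as List
open import Data.List.Membership.Propositional using (_∈_)
open import Data.List.Membership.Propositional.Properties using (∈-map⁺; ∈-map⁻; ∈-++⁺ˡ; ∈-++⁺ʳ)
open import Data.List.NonEmpty using (List⁺; _∷_)
import Data.List.NonEmpty as List⁺
open import Data.List.Properties using (foldr-preservesᵇ)
open import Data.List.Relation.Unary.All using (universal)
open import Data.List.Relation.Unary.All.Properties using (map⁺)
open import Data.List.Relation.Unary.Any using (here; there)
open import Data.Nat using (ℕ; zero; suc; _+_; _*_; _∸_; _≤_; _<_; _⊓_; _⊔_; _≤ᵇ_; z≤n; s≤s)
open import Data.Nat.Properties
  using (≤-refl; ≤-reflexive; ≤-trans; <⇒≱; 1+n≰n; ⊔-lub; ⊓-glb; m≤m⊔n; m≤n⊔m; m⊓n≤m; m⊓n≤n;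
         m≤n+m; +-monoˡ-≤; +-monoʳ-≤; +-identityʳ; +-distribˡ-⊓; ≤ᵇ⇒≤; n∸n≡0)
open import Data.Product using (Σ; Σ-syntax; ∃; _×_; _,_; proj₁; proj₂)
open import Data.Sum using (_⊎_; inj₁; inj₂)
open import Data.Vec using ([]; _∷_; lookup; _++_)
import Data.Vec as Vec
open import Data.Vec.Properties
  using (lookup-map; lookup-replicate; tabulate∘lookup; lookup-++ˡ; lookup-++ʳ; lookup⇒[]=; []=⇒lookup)
open import Function using (_∘_)
open import Function.Bundles using (Inverse; Equivalence; mk⇔)
open import Function.Construct.Identity using (↔-id)
open import Function.Definitions using (Injective)
open import Relation.Binary.PropositionalEquality using (_≡_; _≢_; refl; sym; trans; cong; cong₂; subst)
open import Relation.Nullary using (¬_; yes; no)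

module _ {A : Set} (f : A → ℕ) where

  maxL⁺-map-≤ : ∀ {z} (xs : List⁺ A) → (∀ {x} → x ∈ List⁺.toList xs → f x ≤ z) →
                maxL⁺ (List⁺.map f xs) ≤ z
  maxL⁺-map-≤ (x ∷ xs) = go x xs
    where
    go : ∀ {z} x xs → (∀ {w} → w ∈ x ∷ xs → f w ≤ z) → maxL⁺ (List⁺.map f (x ∷ xs)) ≤ z
    go x []       bound = bound (here refl)
    go x (y ∷ ys) bound = ⊔-lub (bound (here refl)) (go y ys (bound ∘ there))

  ≤-maxL⁺-map : ∀ {x} (xs : List⁺ A) → x ∈ List⁺.toList xs → f x ≤ maxL⁺ (List⁺.map f xs)
  ≤-maxL⁺-map (x ∷ [])     (here refl) = ≤-refl
  ≤-maxL⁺-map (x ∷ y ∷ ys) (here refl) = m≤m⊔n (f x) _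
  ≤-maxL⁺-map (x ∷ y ∷ ys) (there x∈) = ≤-trans (≤-maxL⁺-map (y ∷ ys) x∈) (m≤n⊔m (f x) _)

  ≤-minL⁺-map : ∀ {z} (xs : List⁺ A) → (∀ {x} → x ∈ List⁺.toList xs → z ≤ f x) →
                z ≤ minL⁺ (List⁺.map f xs)
  ≤-minL⁺-map (x ∷ xs) = go x xs
    where
    go : ∀ {z} x xs → (∀ {w} → w ∈ x ∷ xs → z ≤ f w) → z ≤ minL⁺ (List⁺.map f (x ∷ xs))
    go x []       bound = bound (here refl)
    go x (y ∷ ys) bound = ⊓-glb (bound (here refl)) (go y ys (bound ∘ there))

  minL⁺-map-≤ : ∀ {x} (xs : List⁺ A) → x ∈ List⁺.toList xs → minL⁺ (List⁺.map f xs) ≤ f x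
  minL⁺-map-≤ (x ∷ [])     (here refl) = ≤-refl
  minL⁺-map-≤ (x ∷ y ∷ ys) (here refl) = m⊓n≤m (f x) _
  minL⁺-map-≤ (x ∷ y ∷ ys) (there x∈) = ≤-trans (m⊓n≤n (f x) _) (minL⁺-map-≤ (y ∷ ys) x∈)

head∈toList : ∀ {A : Set} (xs : List⁺ A) → List⁺.head xs ∈ List⁺.toList xs
head∈toList (x ∷ xs) = here refl

∈-toList-map⁺ : ∀ {A B : Set} (f : A → B) {x} (xs : List⁺ A) →
                x ∈ List⁺.toList xs → f x ∈ List⁺.toList (List⁺.map f xs)
∈-toList-map⁺ f (x ∷ xs) = ∈-map⁺ f

∈-toList-map⁻ : ∀ {A B : Set} (f : A → B) {y} (xs : List⁺ A) →
                y ∈ List⁺.toList (List⁺.map f xs) → ∃ λ x → x ∈ List⁺.toList xs × y ≡ f x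
∈-toList-map⁻ f (x ∷ xs) = ∈-map⁻ f

lamRho-≤ : ∀ lam ρ G {z} → (∀ X → lam G X ≤ z) → lamRho lam ρ G ≤ z
lamRho-≤ lam record { opt = minmax ; hm = h } G bound =
  ≤-trans (minL⁺-map-≤ _ (F h G) (head∈toList (F h G)))
          (maxL⁺-map-≤ (lam G) (List⁺.head (F h G)) (λ {X} _ → bound X))
lamRho-≤ lam record { opt = maxmin ; hm = h } G bound =
  maxL⁺-map-≤ _ (F h G) λ {H} _ → ≤-trans (minL⁺-map-≤ (lam G) H (head∈toList H)) (bound _)

rhoVal-≤-n : ∀ ρ G → rhoVal ρ G ≤ n G
rhoVal-≤-n ρ G = lamRho-≤ card ρ G ∣p∣≤n

module _ (lam : Measure) {G G′ : Graph} (φ : Iso G G′) (lam-≤ : ∀ X → lam G X ≤ lam G′ (imgSet φ X)) where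

  maxL⁺-≤-image : ∀ H H′ → _≈H_ {G′} H′ (imgH φ H) →
                  maxL⁺ (List⁺.map (lam G) H) ≤ maxL⁺ (List⁺.map (lam G′) H′)
  maxL⁺-≤-image H H′ H′≈φH = maxL⁺-map-≤ (lam G) H λ {X} X∈H →
    ≤-trans (lam-≤ X)
      (≤-maxL⁺-map (lam G′) H′ (Equivalence.from (H′≈φH (imgSet φ X)) (∈-toList-map⁺ (imgSet φ) H X∈H)))

  minL⁺-≤-image : ∀ H H′ → _≈H_ {G′} H′ (imgH φ H) →
                  minL⁺ (List⁺.map (lam G) H) ≤ minL⁺ (List⁺.map (lam G′) H′)
  minL⁺-≤-image H H′ H′≈φH = ≤-minL⁺-map (lam G′) H′ λ {X′} X′∈H′ →
    let X , X∈H , X′≡φX = ∈-toList-map⁻ (imgSet φ) H (Equivalence.to (H′≈φH X′) X′∈H′)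
    in subst (λ Y → _ ≤ lam G′ Y) (sym X′≡φX) (≤-trans (minL⁺-map-≤ (lam G) H X∈H) (lam-≤ X))

  lamRho-mono-iso : ∀ ρ → lamRho lam ρ G ≤ lamRho lam ρ G′
  lamRho-mono-iso record { opt = minmax ; hm = h } =
    ≤-minL⁺-map _ (F h G′) λ {H′} H′∈ →
      let H , H∈ , H′≈φH = compat← h G G′ φ H′ H′∈
      in ≤-trans (minL⁺-map-≤ _ (F h G) H∈) (maxL⁺-≤-image H H′ H′≈φH)
  lamRho-mono-iso record { opt = maxmin ; hm = h } =
    maxL⁺-map-≤ _ (F h G) λ {H} H∈ →
      let H′ , H′∈ , H′≈φH = compat→ h G G′ φ H H∈
      in ≤-trans (minL⁺-≤-image H H′ H′≈φH) (≤-maxL⁺-map _ (F h G′) H′∈)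

Complete : Graph → Set
Complete G = ∀ i j → adj G i j ≡ neqF i j

rhoVal-K≤complete : ∀ ρ G → Complete G → rhoVal ρ (K (n G)) ≤ rhoVal ρ G
rhoVal-K≤complete ρ G complete =
  lamRho-mono-iso card φ (λ X → ≤-reflexive (cong ∣_∣ (sym (tabulate∘lookup X)))) ρ
  where
  φ : Iso (K (n G)) G
  φ = record { π = ↔-id _ ; preserv = complete }

neqF≡false⇒≡ : ∀ {m} {i j : Fin m} → neqF i j ≡ false → i ≡ j
neqF≡false⇒≡ {i = zero}  {zero}  _  = refl
neqF≡false⇒≡ {i = suc i} {suc j} eq = cong suc (neqF≡false⇒≡ eq)

neqF≡true⇒≢ : ∀ {m} {i j : Fin m} → neqF i j ≡ true → i ≢ j
neqF≡true⇒≢ {i = i} eq refl with trans (sym (neqF-irr i)) eq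
... | ()

≢⇒neqF≡true : ∀ {m} {i j : Fin m} → i ≢ j → neqF i j ≡ true
≢⇒neqF≡true {i = zero}  {zero}  i≢j = ⊥-elim (i≢j refl)
≢⇒neqF≡true {i = zero}  {suc j} _   = refl
≢⇒neqF≡true {i = suc i} {zero}  _   = refl
≢⇒neqF≡true {i = suc i} {suc j} i≢j = ≢⇒neqF≡true (i≢j ∘ cong suc)

neqF-injective : ∀ {m k} {f : Fin m → Fin k} → Injective _≡_ _≡_ f → ∀ a b → neqF (f a) (f b) ≡ neqF a b
neqF-injective {f = f} f-inj a b with a ≟ b
... | yes refl = trans (neqF-irr (f a)) (sym (neqF-irr a))
... | no a≢b   = trans (≢⇒neqF≡true (a≢b ∘ f-inj)) (sym (≢⇒neqF≡true a≢b))

_∈ₛ_ : ∀ {m} → Fin m → Subset m → Set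
i ∈ₛ P = lookup P i ≡ true

_⊆ₛ_ : ∀ {m} → Subset m → Subset m → Set
P ⊆ₛ S = ∀ {i} → i ∈ₛ P → i ∈ₛ S

Disjoint : ∀ {m} → Subset m → Subset m → Set
Disjoint P S = ∀ {i} → i ∈ₛ P → lookup S i ≡ false

⊆⊤ : ∀ {m} (P : Subset m) → P ⊆ₛ ⊤
⊆⊤ P {i} _ = lookup-replicate i true

∉⊥ : ∀ {m} (i : Fin m) → ¬ i ∈ₛ ⊥
∉⊥ i i∈⊥ with trans (sym (lookup-replicate i false)) i∈⊥
... | ()

Disjoint⇒⊆∁ : ∀ {m} {P S : Subset m} → Disjoint P S → P ⊆ₛ ∁ S
Disjoint⇒⊆∁ {S = S} P∩S=∅ {i} i∈P = trans (lookup-map i not S) (cong not (P∩S=∅ i∈P))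

∣++∣ : ∀ {a b} (xs : Subset a) (ys : Subset b) → ∣ xs ++ ys ∣ ≡ ∣ xs ∣ + ∣ ys ∣
∣++∣ []          ys = refl
∣++∣ (true ∷ xs)  ys = cong suc (∣++∣ xs ys)
∣++∣ (false ∷ xs) ys = ∣++∣ xs ys

∈-++⁻ : ∀ {m N} (xs : Subset m) (ys : Subset N) {i} → i ∈ₛ (xs ++ ys) →
        (∃ λ a → i ≡ a ↑ˡ N × a ∈ₛ xs) ⊎ (∃ λ b → i ≡ m ↑ʳ b × b ∈ₛ ys)
∈-++⁻ {m} xs ys {i} i∈ with splitAt m i in eq
... | inj₁ a with refl ← splitAt⁻¹-↑ˡ eq = inj₁ (a , refl , trans (sym (lookup-++ˡ xs ys a)) i∈)
... | inj₂ b with refl ← splitAt⁻¹-↑ʳ eq = inj₂ (b , refl , trans (sym (lookup-++ʳ xs ys b)) i∈)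

restrict : ∀ {m} (X : Subset m) → Subset m → Subset ∣ X ∣
restrict []          []      = []
restrict (true ∷ X)  (b ∷ P) = b ∷ restrict X P
restrict (false ∷ X) (b ∷ P) = restrict X P

extend : ∀ {m} (X : Subset m) → Subset ∣ X ∣ → Subset m
extend []          S       = []
extend (true ∷ X)  (b ∷ S) = b ∷ extend X S
extend (false ∷ X) S       = false ∷ extend X S

lookup-restrict : ∀ {m} (X P : Subset m) a → lookup (restrict X P) a ≡ lookup P (embed X a)
lookup-restrict (true ∷ X)  (b ∷ P) zero    = refl
lookup-restrict (true ∷ X)  (b ∷ P) (suc a) = lookup-restrict X P a
lookup-restrict (false ∷ X) (b ∷ P) a       = lookup-restrict X P a

lookup-extend : ∀ {m} (X : Subset m) S a → lookup (extend X S) (embed X a) ≡ lookup S a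
lookup-extend (true ∷ X)  (b ∷ S) zero    = refl
lookup-extend (true ∷ X)  (b ∷ S) (suc a) = lookup-extend X S a
lookup-extend (false ∷ X) S       a       = lookup-extend X S a

∣restrict∣ : ∀ {m} (X P : Subset m) → P ⊆ₛ X → ∣ restrict X P ∣ ≡ ∣ P ∣
∣restrict∣ []          []          _   = refl
∣restrict∣ (true ∷ X)  (true ∷ P)  P⊆X = cong suc (∣restrict∣ X P (λ {i} → P⊆X {suc i}))
∣restrict∣ (true ∷ X)  (false ∷ P) P⊆X = ∣restrict∣ X P (λ {i} → P⊆X {suc i})
∣restrict∣ (false ∷ X) (true ∷ P)  P⊆X with P⊆X {zero} refl
... | ()
∣restrict∣ (false ∷ X) (false ∷ P) P⊆X = ∣restrict∣ X P (λ {i} → P⊆X {suc i})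

restrict-extend : ∀ {m} (X P : Subset m) S {b} → (∀ {i} → i ∈ₛ P → lookup (extend X S) i ≡ b) →
                  ∀ {a} → a ∈ₛ restrict X P → lookup S a ≡ b
restrict-extend X P S P⇒b {a} a∈ =
  trans (sym (lookup-extend X S a)) (P⇒b (trans (sym (lookup-restrict X P a)) a∈))

embed-∈ : ∀ {m} (X : Subset m) a → embed X a ∈ₛ X
embed-∈ (true ∷ X)  zero    = refl
embed-∈ (true ∷ X)  (suc a) = embed-∈ X a
embed-∈ (false ∷ X) a       = embed-∈ X a

embed-injective : ∀ {m} (X : Subset m) → Injective _≡_ _≡_ (embed X)
embed-injective (true ∷ X)  {zero}  {zero}  _  = refl
embed-injective (true ∷ X)  {suc a} {suc b} eq = cong suc (embed-injective X (suc-injective eq))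
embed-injective (false ∷ X)                 eq = embed-injective X (suc-injective eq)

IsClique : (G : Graph) → VSet G → Set
IsClique G P = ∀ {i j} → i ∈ₛ P → j ∈ₛ P → adj G i j ≡ neqF i j

IsIndependent : (G : Graph) → VSet G → Set
IsIndependent G Z = ∀ {i j} → i ∈ₛ Z → j ∈ₛ Z → adj G i j ≡ false

module _ (G : Graph) (X : VSet G) where

  IsClique-restrict : ∀ {P} → IsClique G P → IsClique (induced G X) (restrict X P)
  IsClique-restrict {P} clique {a} {b} a∈ b∈ =
    trans (clique (trans (sym (lookup-restrict X P a)) a∈) (trans (sym (lookup-restrict X P b)) b∈))
          (neqF-injective (embed-injective X) a b)

  IsIndependent-restrict : ∀ {Z} → IsIndependent G Z → IsIndependent (induced G X) (restrict X Z)
  IsIndependent-restrict {Z} independent {a} {b} a∈ b∈ =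
    independent (trans (sym (lookup-restrict X Z a)) a∈) (trans (sym (lookup-restrict X Z b)) b∈)

  IsClique⇒Complete : IsClique G X → Complete (induced G X)
  IsClique⇒Complete clique a b =
    trans (clique (embed-∈ X a) (embed-∈ X b)) (neqF-injective (embed-injective X) a b)

rhoVal-K≤clique : ∀ ρ → Heavy ρ → ∀ G {P} → IsClique G P → rhoVal ρ (K ∣ P ∣) ≤ rhoVal ρ G
rhoVal-K≤clique ρ (monotone , _) G {P} clique =
  ≤-trans (rhoVal-K≤complete ρ (induced G P) (IsClique⇒Complete G P clique)) (monotone G P)

rhoVal-K≤deletion : ∀ ρ → Heavy ρ → ∀ G {P S} → IsClique G P → Disjoint P S →
                    rhoVal ρ (K ∣ P ∣) ≤ rhoVal ρ (G -ˢ S)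
rhoVal-K≤deletion ρ heavy G {P} {S} clique P∩S=∅ =
  subst (λ k → rhoVal ρ (K k) ≤ rhoVal ρ (G -ˢ S)) (∣restrict∣ (∁ S) P (Disjoint⇒⊆∁ {P = P} {S} P∩S=∅))
    (rhoVal-K≤clique ρ heavy (G -ˢ S) {restrict (∁ S) P} (IsClique-restrict G (∁ S) {P} clique))

∈-allSubsets : ∀ {m} (W : Subset m) → W ∈ allSubsets m
∈-allSubsets []          = here refl
∈-allSubsets (true ∷ W)  = ∈-++⁺ˡ (∈-map⁺ (true ∷_) (∈-allSubsets W))
∈-allSubsets (false ∷ W) = ∈-++⁺ʳ _ (∈-map⁺ (false ∷_) (∈-allSubsets W))

∈⇒≤-foldr-⊔ : ∀ {x} xs → x ∈ xs → x ≤ foldr _⊔_ 0 xs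
∈⇒≤-foldr-⊔ (y ∷ ys) (here refl) = m≤m⊔n y _
∈⇒≤-foldr-⊔ (y ∷ ys) (there x∈)  = ≤-trans (∈⇒≤-foldr-⊔ ys x∈) (m≤n⊔m y _)

allB-true : ∀ {A : Set} (p : A → Bool) xs → (∀ x → p x ≡ true) → allB p xs ≡ true
allB-true p []       _      = refl
allB-true p (x ∷ xs) always rewrite always x = allB-true p xs always

IsIndependent⇒isIndep : ∀ G {Z} → IsIndependent G Z → isIndep G Z ≡ true
IsIndependent⇒isIndep G {Z} independent =
  allB-true _ (allFin (n G)) λ i → allB-true _ (allFin (n G)) λ j → nonadjacent i j
  where
  nonadjacent : ∀ i j → not (lookup Z i ∧ lookup Z j ∧ adj G i j) ≡ true
  nonadjacent i j with lookup Z i in i∈ | lookup Z j in j∈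
  ... | false | _     = refl
  ... | true  | false = refl
  ... | true  | true  rewrite independent i∈ j∈ = refl

IsIndependent⇒≤αG : ∀ G {Z} → IsIndependent G Z → ∣ Z ∣ ≤ αG G
IsIndependent⇒≤αG G {Z} independent = ∈⇒≤-foldr-⊔ sizes
  (subst (λ b → (if b then ∣ Z ∣ else 0) ∈ sizes) (IsIndependent⇒isIndep G {Z} independent)
         (∈-map⁺ size (∈-allSubsets Z)))
  where
  size : VSet G → ℕ
  size Y = if isIndep G Y then ∣ Y ∣ else 0
  sizes : List ℕ
  sizes = List.map size (allSubsets (n G))

IsIndependent⇒≤αm : ∀ G {Z S} → IsIndependent G Z → Z ⊆ₛ S → ∣ Z ∣ ≤ αm G S
IsIndependent⇒≤αm G {Z} {S} independent Z⊆S =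
  subst (_≤ αm G S) (∣restrict∣ S Z Z⊆S)
    (IsIndependent⇒≤αG (induced G S) {restrict S Z} (IsIndependent-restrict G S {Z} independent))

αG≤n : ∀ G → αG G ≤ n G
αG≤n G =
  foldr-preservesᵇ {P = _≤ n G} {f = _⊔_} ⊔-lub z≤n (map⁺ (universal bounded (allSubsets (n G))))
  where
  bounded : ∀ Y → (if isIndep G Y then ∣ Y ∣ else 0) ≤ n G
  bounded Y with isIndep G Y
  ... | true  = ∣p∣≤n Y
  ... | false = z≤n

αm≤n : ∀ G S → αm G S ≤ n G
αm≤n G S = ≤-trans (αG≤n (induced G S)) (∣p∣≤n S)

alphaMu-elim : ∀ ρ c G (P : ℕ → Set) → (∀ {x y} → P x → P y → P (x ⊓ y)) → P (n G) →
               (∀ S → rhoVal ρ (G -ˢ S) ≤ c → P (αm G S)) → P (alphaMu ρ c G)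
alphaMu-elim ρ c G P P-⊓ P-n P-modulator =
  foldr-preservesᵇ {P = P} {f = _⊓_} P-⊓ P-n (map⁺ (universal P-entry (allSubsets (n G))))
  where
  P-entry : ∀ S → P (if rhoVal ρ (G -ˢ S) ≤ᵇ c then αm G S else n G)
  P-entry S with rhoVal ρ (G -ˢ S) ≤ᵇ c in isModulator
  ... | true  = P-modulator S (≤ᵇ⇒≤ _ c (subst T (sym isModulator) _))
  ... | false = P-n

lamRho-α≤c+alphaMu : ∀ ρ → Inheritable ρ → ∀ c G → lamRho αm ρ G ≤ c + alphaMu ρ c G
lamRho-α≤c+alphaMu ρ inheritable c G = alphaMu-elim ρ c G (λ v → lamRho αm ρ G ≤ c + v)
  (λ {x} {y} ≤c+x ≤c+y → subst (_ ≤_) (sym (+-distribˡ-⊓ c x y)) (⊓-glb ≤c+x ≤c+y))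
  (≤-trans (lamRho-≤ αm ρ G (αm≤n G)) (m≤n+m (n G) c))
  (λ S ρ[G-S]≤c → ≤-trans (inheritable αm isα G S) (+-monoˡ-≤ (αm G S) ρ[G-S]≤c))

CliqueOrIndependent : ℕ → ℕ → (G : Graph) → VSet G → Set
CliqueOrIndependent m t G S =
    (Σ[ P ∈ VSet G ] IsClique G P × ∣ P ∣ ≡ m × Disjoint P S)
  ⊎ (Σ[ Z ∈ VSet G ] IsIndependent G Z × Z ⊆ₛ S × t ≤ ∣ Z ∣)

t≤alphaMu : ∀ ρ → Heavy ρ → ∀ {c m t} G → c < rhoVal ρ (K m) →
            (∀ S → CliqueOrIndependent m t G S) → t ≤ alphaMu ρ c G
t≤alphaMu ρ heavy {c} {m} {t} G c<ρ[Km] cliqueOrIndependent =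
  alphaMu-elim ρ c G (t ≤_) ⊓-glb (≤-trans (t≤αm ⊤ ρ[G-⊤]≤c) (αm≤n G ⊤)) t≤αm
  where
  -- The fold defining alphaMu starts from n G; that t ≤ n G follows since V(G) is a modulator.
  t≤αm : ∀ S → rhoVal ρ (G -ˢ S) ≤ c → t ≤ αm G S
  t≤αm S ρ[G-S]≤c with cliqueOrIndependent S
  ... | inj₁ (P , clique , ∣P∣≡m , P∩S=∅) =
    ⊥-elim (<⇒≱ c<ρ[Km] (subst (λ k → rhoVal ρ (K k) ≤ c) ∣P∣≡m
      (≤-trans (rhoVal-K≤deletion ρ heavy G {P} {S} clique P∩S=∅) ρ[G-S]≤c)))
  ... | inj₂ (Z , independent , Z⊆S , t≤∣Z∣) =
    ≤-trans t≤∣Z∣ (IsIndependent⇒≤αm G {Z} {S} independent Z⊆S)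
  ρ[G-⊤]≤c : rhoVal ρ (G -ˢ ⊤) ≤ c
  ρ[G-⊤]≤c = ≤-trans (rhoVal-≤-n ρ (G -ˢ ⊤)) (subst (_≤ c) (sym ∣∁⊤∣≡0) z≤n)
    where
    ∣∁⊤∣≡0 : ∣ ∁ (⊤ {n G}) ∣ ≡ 0
    ∣∁⊤∣≡0 = trans (∣∁p∣≡n∸∣p∣ (⊤ {n G})) (trans (cong (n G ∸_) (∣⊤∣≡n (n G))) (n∸n≡0 (n G)))

module _ {m t} (G : Graph) (cliqueOrIndependent : ∀ S → CliqueOrIndependent m t G S) where
  private
    V : VSet G
    V = ⊤

  CliqueOrIndependent-induced-⊤ : ∀ S → CliqueOrIndependent m t (induced G ⊤) S
  CliqueOrIndependent-induced-⊤ S with cliqueOrIndependent (extend V S)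
  ... | inj₁ (P , clique , ∣P∣≡m , P∩S=∅) =
    inj₁ (restrict V P , IsClique-restrict G V {P} clique , trans (∣restrict∣ V P (⊆⊤ P)) ∣P∣≡m ,
          restrict-extend V P S P∩S=∅)
  ... | inj₂ (Z , independent , Z⊆S , t≤∣Z∣) =
    inj₂ (restrict V Z , IsIndependent-restrict G V {Z} independent , restrict-extend V Z S Z⊆S ,
          subst (t ≤_) (sym (∣restrict∣ V Z (⊆⊤ Z))) t≤∣Z∣)

colourCliques : ∀ {v k} → (Fin v → Fin k) → Graph
colourCliques {v} colour = record
  { n     = v
  ; adj   = λ i j → neqF i j ∧ not (neqF (colour i) (colour j))
  ; sym   = λ i j → cong₂ (λ a b → a ∧ not b) (neqF-sym i j) (neqF-sym (colour i) (colour j))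
  ; irref = λ i → cong (λ a → a ∧ not (neqF (colour i) (colour i))) (neqF-irr i)
  }

module _ {v k} (colour : Fin v → Fin k) where

  Monochromatic : Subset v → Set
  Monochromatic P = ∃ λ c → ∀ {i} → i ∈ₛ P → colour i ≡ c

  Rainbow : Subset v → Set
  Rainbow Z = ∀ {i j} → i ∈ₛ Z → j ∈ₛ Z → colour i ≡ colour j → i ≡ j

  Monochromatic⇒IsClique : ∀ {P} → Monochromatic P → IsClique (colourCliques colour) P
  Monochromatic⇒IsClique (c , coloured) {i} {j} i∈ j∈
    rewrite coloured i∈ | coloured j∈ | neqF-irr c = ∧-identityʳ (neqF i j)

  Rainbow⇒IsIndependent : ∀ {Z} → Rainbow Z → IsIndependent (colourCliques colour) Z
  Rainbow⇒IsIndependent rainbow {i} {j} i∈ j∈ with neqF (colour i) (colour j) in differ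
  ... | true  = ∧-zeroʳ (neqF i j)
  ... | false rewrite rainbow i∈ j∈ (neqF≡false⇒≡ differ) | neqF-irr j = refl

  colourCliques-isDUC : IsDisjUnionCliques (colourCliques colour)
  colourCliques-isDUC = toℕ ∘ colour , λ i j → mk⇔ (adjacent⇒ i j) (⇒adjacent i j)
    where
    adjacent⇒ : ∀ i j → adj (colourCliques colour) i j ≡ true → i ≢ j × toℕ (colour i) ≡ toℕ (colour j)
    -- In the omitted cases adjacent : false ≡ true.
    adjacent⇒ i j adjacent with neqF i j in i≠j | neqF (colour i) (colour j) in ci≠cj
    ... | true | false = neqF≡true⇒≢ i≠j , cong toℕ (neqF≡false⇒≡ ci≠cj)
    ⇒adjacent : ∀ i j → i ≢ j × toℕ (colour i) ≡ toℕ (colour j) → adj (colourCliques colour) i j ≡ true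
    ⇒adjacent i j (i≢j , ci≡cj)
      rewrite ≢⇒neqF≡true i≢j | toℕ-injective ci≡cj | neqF-irr (colour j) = refl

-- t disjoint copies of K_m, the i-th copy being the i-th block of m consecutive vertices

copiesK : ℕ → ℕ → Graph
copiesK t m = colourCliques (quotient {t} m)

quotient-↑ˡ : ∀ {t} m (a : Fin m) → quotient {suc t} m (a ↑ˡ t * m) ≡ zero
quotient-↑ˡ {t} m a rewrite splitAt-↑ˡ m a (t * m) = refl

quotient-↑ʳ : ∀ {t} m (b : Fin (t * m)) → quotient {suc t} m (m ↑ʳ b) ≡ suc (quotient m b)
quotient-↑ʳ {t} m b rewrite splitAt-↑ʳ m (t * m) b = refl

module _ (m : ℕ) where

  FreeBlock : ∀ t → Subset (t * m) → Set
  FreeBlock t S = Σ[ P ∈ Subset (t * m) ] Monochromatic (quotient {t} m) P × ∣ P ∣ ≡ m × Disjoint P S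

  Transversal : ∀ t → Subset (t * m) → Set
  Transversal t S = Σ[ Z ∈ Subset (t * m) ] Rainbow (quotient {t} m) Z × Z ⊆ₛ S × t ≤ ∣ Z ∣

  firstBlock-free : ∀ {t} (xs : Subset m) (ys : Subset (t * m)) → (∀ a → lookup xs a ≡ false) →
                    FreeBlock (suc t) (xs ++ ys)
  firstBlock-free {t} xs ys xs=∅ = block , (zero , monochromatic) , size , disjoint
    where
    block : Subset (suc t * m)
    block = ⊤ {m} ++ ⊥ {t * m}
    monochromatic : ∀ {i} → i ∈ₛ block → quotient m i ≡ zero
    monochromatic {i} i∈ with ∈-++⁻ (⊤ {m}) (⊥ {t * m}) {i} i∈
    ... | inj₁ (a , refl , _)  = quotient-↑ˡ m a
    ... | inj₂ (b , refl , b∈) = ⊥-elim (∉⊥ b b∈)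
    size : ∣ block ∣ ≡ m
    size = trans (∣++∣ (⊤ {m}) (⊥ {t * m})) (trans (cong₂ _+_ (∣⊤∣≡n m) (∣⊥∣≡0 (t * m))) (+-identityʳ m))
    disjoint : Disjoint block (xs ++ ys)
    disjoint {i} i∈ with ∈-++⁻ (⊤ {m}) (⊥ {t * m}) {i} i∈
    ... | inj₁ (a , refl , _)  = trans (lookup-++ˡ xs ys a) (xs=∅ a)
    ... | inj₂ (b , refl , b∈) = ⊥-elim (∉⊥ b b∈)

  laterBlock-free : ∀ {t} (xs : Subset m) (ys : Subset (t * m)) → FreeBlock t ys →
                    FreeBlock (suc t) (xs ++ ys)
  laterBlock-free {t} xs ys (P , (c , monochromatic) , size , disjoint) =
    ⊥ {m} ++ P , (suc c , monochromatic′) , size′ , disjoint′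
    where
    size′ : ∣ ⊥ {m} ++ P ∣ ≡ m
    size′ = trans (∣++∣ (⊥ {m}) P) (trans (cong (_+ ∣ P ∣) (∣⊥∣≡0 m)) size)
    monochromatic′ : ∀ {i} → i ∈ₛ (⊥ {m} ++ P) → quotient m i ≡ suc c
    monochromatic′ {i} i∈ with ∈-++⁻ (⊥ {m}) P {i} i∈
    ... | inj₁ (a , refl , a∈) = ⊥-elim (∉⊥ a a∈)
    ... | inj₂ (b , refl , b∈) = trans (quotient-↑ʳ m b) (cong suc (monochromatic b∈))
    disjoint′ : Disjoint (⊥ {m} ++ P) (xs ++ ys)
    disjoint′ {i} i∈ with ∈-++⁻ (⊥ {m}) P {i} i∈
    ... | inj₁ (a , refl , a∈) = ⊥-elim (∉⊥ a a∈)
    ... | inj₂ (b , refl , b∈) = trans (lookup-++ʳ xs ys b) (disjoint b∈)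

  transversal-∷ : ∀ {t} (xs : Subset m) (ys : Subset (t * m)) {a} → a ∈ₛ xs → Transversal t ys →
                  Transversal (suc t) (xs ++ ys)
  transversal-∷ {t} xs ys {a} a∈xs (Z , rainbow , Z⊆ys , t≤∣Z∣) =
    ⁅ a ⁆ ++ Z , rainbow′ , ⊆xs++ys , subst (suc t ≤_) (sym size) (s≤s t≤∣Z∣)
    where
    size : ∣ ⁅ a ⁆ ++ Z ∣ ≡ suc ∣ Z ∣
    size = trans (∣++∣ ⁅ a ⁆ Z) (cong (_+ ∣ Z ∣) (∣⁅x⁆∣≡1 a))
    ∈⁅a⁆ : ∀ {a′} → a′ ∈ₛ ⁅ a ⁆ → a′ ≡ a
    ∈⁅a⁆ {a′} a′∈ = x∈⁅y⁆⇒x≡y a (lookup⇒[]= a′ ⁅ a ⁆ a′∈)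
    first≢later : ∀ a′ b → quotient m (a′ ↑ˡ t * m) ≢ quotient m (m ↑ʳ b)
    first≢later a′ b same = 0≢1+n (trans (sym (quotient-↑ˡ m a′)) (trans same (quotient-↑ʳ m b)))
    rainbow′ : Rainbow (quotient {suc t} m) (⁅ a ⁆ ++ Z)
    rainbow′ {i} {j} i∈ j∈ same with ∈-++⁻ ⁅ a ⁆ Z {i} i∈ | ∈-++⁻ ⁅ a ⁆ Z {j} j∈
    ... | inj₁ (a₁ , refl , a₁∈) | inj₁ (a₂ , refl , a₂∈) =
      cong (_↑ˡ t * m) (trans (∈⁅a⁆ a₁∈) (sym (∈⁅a⁆ a₂∈)))
    ... | inj₁ (a₁ , refl , _)   | inj₂ (b₂ , refl , _)   = ⊥-elim (first≢later a₁ b₂ same)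
    ... | inj₂ (b₁ , refl , _)   | inj₁ (a₂ , refl , _)   = ⊥-elim (first≢later a₂ b₁ (sym same))
    ... | inj₂ (b₁ , refl , b₁∈) | inj₂ (b₂ , refl , b₂∈) =
      cong (m ↑ʳ_) (rainbow b₁∈ b₂∈ (suc-injective
        (trans (sym (quotient-↑ʳ m b₁)) (trans same (quotient-↑ʳ m b₂)))))
    ⊆xs++ys : (⁅ a ⁆ ++ Z) ⊆ₛ (xs ++ ys)
    ⊆xs++ys {i} i∈ with ∈-++⁻ ⁅ a ⁆ Z {i} i∈
    ... | inj₁ (a′ , refl , a′∈) rewrite ∈⁅a⁆ a′∈ = trans (lookup-++ˡ xs ys a) a∈xs
    ... | inj₂ (b , refl , b∈)  = trans (lookup-++ʳ xs ys b) (Z⊆ys b∈)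

  freeBlock-or-transversal : ∀ t S → FreeBlock t S ⊎ Transversal t S
  freeBlock-or-transversal zero    S = inj₂ ([] , (λ {}) , (λ {}) , z≤n)
  freeBlock-or-transversal (suc t) S with Vec.splitAt m S
  ... | xs , ys , refl with nonempty? xs
  ...   | no xs=∅ = inj₁ (firstBlock-free xs ys λ a → ¬-not λ a∈ → xs=∅ (a , lookup⇒[]= a xs a∈))
  ...   | yes (a , a∈xs) with freeBlock-or-transversal t ys
  ...     | inj₁ free        = inj₁ (laterBlock-free xs ys free)
  ...     | inj₂ transversal = inj₂ (transversal-∷ xs ys ([]=⇒lookup a∈xs) transversal)

copiesK-cliqueOrIndependent : ∀ t m S → CliqueOrIndependent m t (copiesK t m) S
copiesK-cliqueOrIndependent t m S with freeBlock-or-transversal m t S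
... | inj₁ (P , monochromatic , size , disjoint) =
  inj₁ (P , Monochromatic⇒IsClique _ {P} monochromatic , size , disjoint)
... | inj₂ (Z , rainbow , Z⊆S , t≤∣Z∣) =
  inj₂ (Z , Rainbow⇒IsIndependent _ {Z} rainbow , Z⊆S , t≤∣Z∣)

IsDisjUnionCliques-embedding : ∀ {G G′} (f : Fin (n G′) → Fin (n G)) → Injective _≡_ _≡_ f →
                               (∀ i j → adj G′ i j ≡ adj G (f i) (f j)) →
                               IsDisjUnionCliques G → IsDisjUnionCliques G′
IsDisjUnionCliques-embedding f f-injective adj-f (part , adjacent⇔) = part ∘ f , λ i j →
  mk⇔ (λ adjacent →
         let i≢j , same = Equivalence.to (adjacent⇔ (f i) (f j)) (trans (sym (adj-f i j)) adjacent)
         in i≢j ∘ cong f , same)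
      (λ (i≢j , same) → trans (adj-f i j) (Equivalence.from (adjacent⇔ (f i) (f j)) (i≢j ∘ f-injective , same)))

IsDisjUnionCliques-iso : ∀ {G G′} → Iso G G′ → IsDisjUnionCliques G → IsDisjUnionCliques G′
IsDisjUnionCliques-iso {G} {G′} φ = IsDisjUnionCliques-embedding {G} {G′} from from-injective adj-from
  where
  open Inverse (π φ) using (to; from; strictlyInverseˡ)
  adj-from : ∀ i j → adj G′ i j ≡ adj G (from i) (from j)
  adj-from i j =
    trans (cong₂ (adj G′) (sym (strictlyInverseˡ i)) (sym (strictlyInverseˡ j))) (preserv φ (from i) (from j))
  from-injective : Injective _≡_ _≡_ from
  from-injective {i} {j} eq = trans (sym (strictlyInverseˡ i)) (trans (cong to eq) (strictlyInverseˡ j))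

IsDisjUnionCliques-induced : ∀ G (X : VSet G) → IsDisjUnionCliques G → IsDisjUnionCliques (induced G X)
IsDisjUnionCliques-induced G X =
  IsDisjUnionCliques-embedding {G} {induced G X} (embed X) (embed-injective X) (λ _ _ → refl)

disjUnionsOfCliques : GraphClass
disjUnionsOfCliques = record { mem = IsDisjUnionCliques ; closed = λ _ _ → IsDisjUnionCliques-iso }

InUnionBMu⇒InBAlphaRho : ∀ ρ → Inheritable ρ → ∀ 𝒢 → InUnionBMu ρ 𝒢 → InBAlphaRho ρ 𝒢
InUnionBMu⇒InBAlphaRho ρ inheritable 𝒢 (c , k , bounded) =
  c + k , λ G G∈𝒢 X →
    ≤-trans (lamRho-α≤c+alphaMu ρ inheritable c (induced G X)) (+-monoʳ-≤ c (bounded G G∈𝒢 X))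

disjUnionsOfCliques-∉UnionBMu : ∀ ρ → Heavy ρ → ¬ InUnionBMu ρ disjUnionsOfCliques
disjUnionsOfCliques-∉UnionBMu ρ heavy (c , k , bounded) = 1+n≰n (≤-trans k<alphaMu (bounded G G-isDUC ⊤))
  where
  m = proj₁ (proj₂ heavy c)
  G = copiesK (suc k) m
  G-isDUC : IsDisjUnionCliques G
  G-isDUC = colourCliques-isDUC (quotient m)
  k<alphaMu : suc k ≤ alphaMu ρ c (induced G ⊤)
  k<alphaMu = t≤alphaMu ρ heavy (induced G ⊤) (proj₂ (proj₂ heavy c))
                (CliqueOrIndependent-induced-⊤ G (copiesK-cliqueOrIndependent (suc k) m))

proposition5p20 : (ρ : BasicHyperparameter) → Inheritable ρ → Heavy ρ →
    Σ ℕ (λ k → ∀ G → IsDisjUnionCliques G → lamRho αm ρ G ≤ k) →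
    (∀ (𝒢 : GraphClass) → InUnionBMu ρ 𝒢 → InBAlphaRho ρ 𝒢)
    × Σ GraphClass (λ 𝒢 → InBAlphaRho ρ 𝒢 × ¬ InUnionBMu ρ 𝒢)
proposition5p20 ρ inheritable heavy (k , bounded) =
  InUnionBMu⇒InBAlphaRho ρ inheritable ,
  disjUnionsOfCliques ,
  (k , λ G G-isDUC X → bounded (induced G X) (IsDisjUnionCliques-induced G X G-isDUC)) ,
  disjUnionsOfCliques-∉UnionBMu ρ heavy
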